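{- Let $t\geq 3$ be an integer and let $G$ be a graph on $n<2(t-1)$ vertices that contains a copy of $K_{t-1}$. If the intersection of the vertex sets $V(H)$ over all subgraphs $H\subseteq G$ with $H\cong K_{t-1}$ is empty, then $G$ contains a copy of $K_t$.
   Context: Graphs are finite and simple; $K_s$ denotes the complete graph on $s$ vertices. -}

module Defs where

open import Level using (0ℓ)
open import Data.Nat using (ℕ)
open import Data.Fin using (Fin)
open import Data.Product using (Σ; ∃; _×_)
open import Relation.Nullary using (¬_; Dec)
open import Relation.Binary.PropositionalEquality using (_≡_; _≢_)
open import Function.Definitions using (Injective)

record Graph (n : ℕ) : Set₁ where
  field
    Adj     : Fin n → Fin n → Set
    adj?    : ∀ u v → Dec (Adj u v)
    sym     : ∀ {u v} → Adj u v → Adj v u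
    irrefl  : ∀ {u} → ¬ Adj u u

open Graph public

-- A copy of K_s in G (a subgraph H ⊆ G with H ≅ K_s): an injective map
-- from the s vertices of K_s into V(G) whose images are pairwise adjacent.
record Clique {n : ℕ} (G : Graph n) (s : ℕ) : Set where
  field
    emb       : Fin s → Fin n
    emb-inj   : Injective _≡_ _≡_ emb
    emb-adj   : ∀ i j → i ≢ j → Adj G (emb i) (emb j)

open Clique public

_∈V_ : {n s : ℕ} {G : Graph n} → Fin n → Clique G s → Set
v ∈V H = ∃ λ i → emb H i ≡ v

-- Write N(X) for the set of vertices that fail to be adjacent to some other
-- vertex of X, and call a clique X good if |N(X)| < |X|.  For a clique X, the
-- sets X and N(X) are disjoint, so n < 2(t-1) makes the given K_{t-1} good.
-- Given a good X, pick v ∈ X and a copy I of K_{t-1} avoiding v.  If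
-- |I ∩ N(X)| < |X ∖ I|, then (I ∖ N(X)) ∪ (X ∖ I) is a clique with more than
-- |I| = t-1 vertices.  Otherwise X ∩ I is again good, as N(X ∩ I) ⊆ N(X) ∖ I,
-- and it is smaller than X because v ∉ I; so this descent must stop.

module Submission where

open import Defs
open import Data.Nat using (ℕ; _≤_; _<_; _*_; _∸_)
open import Data.Fin using (Fin)
open import Data.Product using (Σ; ∃)
open import Relation.Nullary using (¬_)

open import Level using (Level; 0ℓ)
open import Data.Nat using (zero; suc; _+_; z≤n; s≤s)
open import Data.Nat.Properties
  using ( +-suc; +-identityʳ; +-comm; +-mono-≤; +-monoʳ-≤; +-monoˡ-<; +-cancelʳ-<
        ; ≤-<-trans; <-≤-trans; >⇒≢; ≰⇒>; m<m+n; _≤?_; module ≤-Reasoning )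
open import Data.Nat.Induction using (<-wellFounded)
open import Data.Fin using (zero; suc; _≟_)
open import Data.Fin.Properties using (any?; suc-injective; 0≢1+n)
open import Data.Fin.Subset
open import Data.Fin.Subset.Properties
open import Data.Product using (_,_; _×_)
open import Data.Sum using (inj₁; inj₂)
open import Data.Vec using (_∷_; []; here; there; tabulate)
open import Data.Vec.Properties using (lookup∘tabulate; lookup⇒[]=; []=⇒lookup)
open import Function using (_∘_)
open import Function.Definitions using (Injective)
open import Induction.WellFounded using (Acc; acc)
open import Relation.Nullary using (Dec; yes; no; does; ¬?; contradiction)
open import Relation.Nullary.Decidable using (dec-true; _×-dec_)
open import Relation.Unary using (Pred; Decidable)
open import Relation.Binary.PropositionalEquality
  using (_≡_; _≢_; refl; trans; cong; subst; module ≡-Reasoning) renaming (sym to ≡-sym)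

private
  variable
    ℓ : Level
    n s : ℕ

∣p∣≡∣p∩q∣+∣p─q∣ : ∀ (p q : Subset n) → ∣ p ∣ ≡ ∣ p ∩ q ∣ + ∣ p ─ q ∣
∣p∣≡∣p∩q∣+∣p─q∣ [] [] = refl
∣p∣≡∣p∩q∣+∣p─q∣ (inside ∷ p) (inside ∷ q) = cong suc (∣p∣≡∣p∩q∣+∣p─q∣ p q)
∣p∣≡∣p∩q∣+∣p─q∣ (inside ∷ p) (outside ∷ q) =
  trans (cong suc (∣p∣≡∣p∩q∣+∣p─q∣ p q)) (≡-sym (+-suc _ _))
∣p∣≡∣p∩q∣+∣p─q∣ (outside ∷ p) (inside ∷ q) = ∣p∣≡∣p∩q∣+∣p─q∣ p q
∣p∣≡∣p∩q∣+∣p─q∣ (outside ∷ p) (outside ∷ q) = ∣p∣≡∣p∩q∣+∣p─q∣ p q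

∣p∪q∣+∣p∩q∣≡∣p∣+∣q∣ : ∀ (p q : Subset n) → ∣ p ∪ q ∣ + ∣ p ∩ q ∣ ≡ ∣ p ∣ + ∣ q ∣
∣p∪q∣+∣p∩q∣≡∣p∣+∣q∣ [] [] = refl
∣p∪q∣+∣p∩q∣≡∣p∣+∣q∣ (inside ∷ p) (inside ∷ q) =
  cong suc (trans (+-suc _ _)
    (trans (cong suc (∣p∪q∣+∣p∩q∣≡∣p∣+∣q∣ p q)) (≡-sym (+-suc _ _))))
∣p∪q∣+∣p∩q∣≡∣p∣+∣q∣ (inside ∷ p) (outside ∷ q) = cong suc (∣p∪q∣+∣p∩q∣≡∣p∣+∣q∣ p q)
∣p∪q∣+∣p∩q∣≡∣p∣+∣q∣ (outside ∷ p) (inside ∷ q) =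
  trans (cong suc (∣p∪q∣+∣p∩q∣≡∣p∣+∣q∣ p q)) (≡-sym (+-suc _ _))
∣p∪q∣+∣p∩q∣≡∣p∣+∣q∣ (outside ∷ p) (outside ∷ q) = ∣p∪q∣+∣p∩q∣≡∣p∣+∣q∣ p q

Empty[p∩q]⇒∣p∪q∣≡∣p∣+∣q∣ : ∀ (p q : Subset n) → Empty (p ∩ q) → ∣ p ∪ q ∣ ≡ ∣ p ∣ + ∣ q ∣
Empty[p∩q]⇒∣p∪q∣≡∣p∣+∣q∣ {n} p q p∩q-empty = begin
  ∣ p ∪ q ∣              ≡⟨ ≡-sym (+-identityʳ _) ⟩
  ∣ p ∪ q ∣ + 0          ≡⟨ cong (∣ p ∪ q ∣ +_) (≡-sym (∣⊥∣≡0 n)) ⟩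
  ∣ p ∪ q ∣ + ∣ ⊥ {n} ∣  ≡⟨ cong (λ r → ∣ p ∪ q ∣ + ∣ r ∣) (≡-sym p∩q≡⊥) ⟩
  ∣ p ∪ q ∣ + ∣ p ∩ q ∣  ≡⟨ ∣p∪q∣+∣p∩q∣≡∣p∣+∣q∣ p q ⟩
  ∣ p ∣ + ∣ q ∣          ∎
  where
  open ≡-Reasoning
  p∩q≡⊥ : p ∩ q ≡ ⊥
  p∩q≡⊥ = Empty-unique p∩q-empty

x∈p─q⇒x∉q : ∀ {p q : Subset n} {x} → x ∈ p ─ q → x ∉ q
x∈p─q⇒x∉q {p = _ ∷ _} {q = outside ∷ _} (there x∈p─q) (there x∈q) = x∈p─q⇒x∉q x∈p─q x∈q
x∈p─q⇒x∉q {p = _ ∷ _} {q = inside  ∷ _} (there x∈p─q) (there x∈q) = x∈p─q⇒x∉q x∈p─q x∈q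

∣p∩r∣<∣q─p∣⇒∣p∣<∣[p─r]∪[q─p]∣ : ∀ (p q r : Subset n) →
  ∣ p ∩ r ∣ < ∣ q ─ p ∣ → ∣ p ∣ < ∣ (p ─ r) ∪ (q ─ p) ∣
∣p∩r∣<∣q─p∣⇒∣p∣<∣[p─r]∪[q─p]∣ p q r ∣p∩r∣<∣q─p∣ = begin-strict
  ∣ p ∣                     ≡⟨ ∣p∣≡∣p∩q∣+∣p─q∣ p r ⟩
  ∣ p ∩ r ∣ + ∣ p ─ r ∣     <⟨ +-monoˡ-< ∣ p ─ r ∣ ∣p∩r∣<∣q─p∣ ⟩
  ∣ q ─ p ∣ + ∣ p ─ r ∣     ≡⟨ +-comm ∣ q ─ p ∣ ∣ p ─ r ∣ ⟩
  ∣ p ─ r ∣ + ∣ q ─ p ∣     ≡⟨ ≡-sym (Empty[p∩q]⇒∣p∪q∣≡∣p∣+∣q∣ (p ─ r) (q ─ p) disjoint) ⟩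
  ∣ (p ─ r) ∪ (q ─ p) ∣     ∎
  where
  open ≤-Reasoning
  disjoint : Empty ((p ─ r) ∩ (q ─ p))
  disjoint (x , x∈) with x∈p∩q⁻ (p ─ r) (q ─ p) x∈
  ... | x∈p─r , x∈q─p = x∈p─q⇒x∉q x∈q─p (p─q⊆p p r x∈p─r)

x∈p⇒0<∣p∣ : ∀ {p : Subset n} {x} → x ∈ p → 0 < ∣ p ∣
x∈p⇒0<∣p∣ x∈p = ≤-<-trans z≤n (x∈p⇒∣p-x∣<∣p∣ x∈p)

0<∣p∣⇒Nonempty : ∀ (p : Subset n) → 0 < ∣ p ∣ → Nonempty p
0<∣p∣⇒Nonempty {n} p 0<∣p∣ with nonempty? p
... | yes p-nonempty = p-nonempty
... | no  p-empty    =
  contradiction (trans (cong ∣_∣ (Empty-unique p-empty)) (∣⊥∣≡0 n)) (>⇒≢ 0<∣p∣)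

injection⇒≤∣p∣ : ∀ {p : Subset n} (f : Fin s → Fin n) →
                 Injective _≡_ _≡_ f → (∀ i → f i ∈ p) → s ≤ ∣ p ∣
injection⇒≤∣p∣ {s = zero}  f f-inj f∈p = z≤n
injection⇒≤∣p∣ {s = suc s} f f-inj f∈p =
  ≤-<-trans (injection⇒≤∣p∣ (f ∘ suc) (suc-injective ∘ f-inj) f∘suc∈p-f₀)
            (x∈p⇒∣p-x∣<∣p∣ (f∈p zero))
  where
  f∘suc∈p-f₀ : ∀ i → f (suc i) ∈ _ - f zero
  f∘suc∈p-f₀ i = x∈p∧x≢y⇒x∈p-y (f∈p (suc i)) (λ eq → 0≢1+n (≡-sym (f-inj eq)))

select : ∀ (p : Subset n) → s ≤ ∣ p ∣ → Fin s → Fin n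
select []            z≤n      ()
select (outside ∷ p) s≤       i       = suc (select p s≤ i)
select (inside  ∷ p) (s≤s _)  zero    = zero
select (inside  ∷ p) (s≤s s≤) (suc i) = suc (select p s≤ i)

select-∈ : ∀ (p : Subset n) (s≤ : s ≤ ∣ p ∣) i → select p s≤ i ∈ p
select-∈ []            z≤n      ()
select-∈ (outside ∷ p) s≤       i       = there (select-∈ p s≤ i)
select-∈ (inside  ∷ p) (s≤s _)  zero    = here
select-∈ (inside  ∷ p) (s≤s s≤) (suc i) = there (select-∈ p s≤ i)

select-injective : ∀ (p : Subset n) (s≤ : s ≤ ∣ p ∣) → Injective _≡_ _≡_ (select p s≤)
select-injective []            z≤n      {()}
select-injective (outside ∷ p) s≤       {i}     {j}     eq =
  select-injective p s≤ (suc-injective eq)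
select-injective (inside  ∷ p) (s≤s _)  {zero}  {zero}  _  = refl
select-injective (inside  ∷ p) (s≤s s≤) {suc i} {suc j} eq =
  cong suc (select-injective p s≤ (suc-injective eq))

fromDec : ∀ {P : Pred (Fin n) ℓ} → Decidable P → Subset n
fromDec P? = tabulate (does ∘ P?)

∈-fromDec⁺ : ∀ {P : Pred (Fin n) ℓ} (P? : Decidable P) {x} → P x → x ∈ fromDec P?
∈-fromDec⁺ P? {x} px = lookup⇒[]= x _ (trans (lookup∘tabulate _ x) (dec-true (P? x) px))

∈-fromDec⁻ : ∀ {P : Pred (Fin n) ℓ} (P? : Decidable P) {x} → x ∈ fromDec P? → P x
∈-fromDec⁻ P? {x} x∈
  with P? x | trans (≡-sym (lookup∘tabulate (does ∘ P?) x)) ([]=⇒lookup x∈)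
... | yes px | _ = px
... | no  _  | ()

module _ {n : ℕ} (G : Graph n) where

  IsClique : Subset n → Set
  IsClique p = ∀ {u w} → u ∈ p → w ∈ p → u ≢ w → Adj G u w

  IsClique-⊆ : ∀ {p q} → p ⊆ q → IsClique q → IsClique p
  IsClique-⊆ p⊆q q-clique u∈p w∈p = q-clique (p⊆q u∈p) (p⊆q w∈p)

  IsClique⇒Clique : ∀ {p} → IsClique p → s ≤ ∣ p ∣ → Clique G s
  IsClique⇒Clique {p = p} p-clique s≤∣p∣ = record
    { emb     = select p s≤∣p∣
    ; emb-inj = select-injective p s≤∣p∣
    ; emb-adj = λ i j i≢j →
        p-clique (select-∈ p s≤∣p∣ i) (select-∈ p s≤∣p∣ j) (i≢j ∘ select-injective p s≤∣p∣)
    }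

  _∈V?_ : ∀ u (H : Clique G s) → Dec (u ∈V H)
  u ∈V? H = any? (λ i → emb H i ≟ u)

  vertices : Clique G s → Subset n
  vertices H = fromDec (_∈V? H)

  vertices-isClique : ∀ (H : Clique G s) → IsClique (vertices H)
  vertices-isClique H u∈H w∈H u≢w
    with ∈-fromDec⁻ (_∈V? H) u∈H | ∈-fromDec⁻ (_∈V? H) w∈H
  ... | i , refl | j , refl = emb-adj H i j (u≢w ∘ cong (emb H))

  s≤∣vertices∣ : ∀ (H : Clique G s) → s ≤ ∣ vertices H ∣
  s≤∣vertices∣ H = injection⇒≤∣p∣ (emb H) (emb-inj H) (λ i → ∈-fromDec⁺ (_∈V? H) (i , refl))

  NonJoined : Subset n → Pred (Fin n) 0ℓ
  NonJoined X u = ∃ λ x → x ∈ X × x ≢ u × ¬ Adj G x u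

  nonJoined? : ∀ X → Decidable (NonJoined X)
  nonJoined? X u = any? (λ x → x ∈? X ×-dec ¬? (x ≟ u) ×-dec ¬? (adj? G x u))

  nonJoined : Subset n → Subset n
  nonJoined X = fromDec (nonJoined? X)

  nonJoined-disjoint : ∀ {X} → IsClique X → Empty (nonJoined X ∩ X)
  nonJoined-disjoint {X} X-clique (u , u∈N∩X) with x∈p∩q⁻ (nonJoined X) X u∈N∩X
  ... | u∈N , u∈X with ∈-fromDec⁻ (nonJoined? X) u∈N
  ... | x , x∈X , x≢u , ¬adj = ¬adj (X-clique x∈X u∈X x≢u)

  ∉nonJoined⇒Adj : ∀ {X u x} → u ∉ nonJoined X → x ∈ X → x ≢ u → Adj G x u
  ∉nonJoined⇒Adj {X} {u} {x} u∉N x∈X x≢u with adj? G x u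
  ... | yes adj = adj
  ... | no ¬adj = contradiction (∈-fromDec⁺ (nonJoined? X) (x , x∈X , x≢u , ¬adj)) u∉N

  ∪-isClique : ∀ {X Y} → IsClique X → IsClique Y →
               (∀ {y} → y ∈ Y → y ∉ nonJoined X) → IsClique (Y ∪ X)
  ∪-isClique {X} {Y} X-clique Y-clique Y∉N u∈ w∈ u≢w with x∈p∪q⁻ Y X u∈ | x∈p∪q⁻ Y X w∈
  ... | inj₁ u∈Y | inj₁ w∈Y = Y-clique u∈Y w∈Y u≢w
  ... | inj₂ u∈X | inj₂ w∈X = X-clique u∈X w∈X u≢w
  ... | inj₁ u∈Y | inj₂ w∈X = Graph.sym G (∉nonJoined⇒Adj (Y∉N u∈Y) w∈X (u≢w ∘ ≡-sym))
  ... | inj₂ u∈X | inj₁ w∈Y = ∉nonJoined⇒Adj (Y∉N w∈Y) u∈X u≢w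

  nonJoined-∩ : ∀ {X I} → IsClique I → nonJoined (X ∩ I) ⊆ nonJoined X ─ I
  nonJoined-∩ {X} {I} I-clique u∈N′ with ∈-fromDec⁻ (nonJoined? (X ∩ I)) u∈N′
  ... | x , x∈X∩I , x≢u , ¬adj with x∈p∩q⁻ X I x∈X∩I
  ... | x∈X , x∈I = x∈p∧x∉q⇒x∈p─q (∈-fromDec⁺ (nonJoined? X) (x , x∈X , x≢u , ¬adj))
                                  (λ u∈I → ¬adj (I-clique x∈I u∈I x≢u))

  exchange-isClique : ∀ {X I} → IsClique X → IsClique I →
                      IsClique ((I ─ nonJoined X) ∪ (X ─ I))
  exchange-isClique {X} {I} X-clique I-clique =
    IsClique-⊆ shrink-right
      (∪-isClique X-clique (IsClique-⊆ (p─q⊆p I (nonJoined X)) I-clique) x∈p─q⇒x∉q)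
    where
    shrink-right : (I ─ nonJoined X) ∪ (X ─ I) ⊆ (I ─ nonJoined X) ∪ X
    shrink-right y∈ with x∈p∪q⁻ (I ─ nonJoined X) (X ─ I) y∈
    ... | inj₁ y∈I─N = x∈p∪q⁺ (inj₁ y∈I─N)
    ... | inj₂ y∈X─I = x∈p∪q⁺ (inj₂ (p─q⊆p X I y∈X─I))

  ∣nonJoined[X∩I]∣<∣X∩I∣ : ∀ {X I} → IsClique I → ∣ X ─ I ∣ ≤ ∣ I ∩ nonJoined X ∣ →
                           ∣ nonJoined X ∣ < ∣ X ∣ → ∣ nonJoined (X ∩ I) ∣ < ∣ X ∩ I ∣
  ∣nonJoined[X∩I]∣<∣X∩I∣ {X} {I} I-clique X─I≤I∩N N<X =
    +-cancelʳ-< ∣ X ─ I ∣ _ _ (begin-strict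
    ∣ nonJoined (X ∩ I) ∣ + ∣ X ─ I ∣  ≤⟨ +-mono-≤ N′≤N─I X─I≤I∩N ⟩
    ∣ N ─ I ∣ + ∣ I ∩ N ∣              ≡⟨ cong (λ r → ∣ N ─ I ∣ + ∣ r ∣) (∩-comm I N) ⟩
    ∣ N ─ I ∣ + ∣ N ∩ I ∣              ≡⟨ +-comm ∣ N ─ I ∣ ∣ N ∩ I ∣ ⟩
    ∣ N ∩ I ∣ + ∣ N ─ I ∣              ≡⟨ ≡-sym (∣p∣≡∣p∩q∣+∣p─q∣ N I) ⟩
    ∣ N ∣                              <⟨ N<X ⟩
    ∣ X ∣                              ≡⟨ ∣p∣≡∣p∩q∣+∣p─q∣ X I ⟩
    ∣ X ∩ I ∣ + ∣ X ─ I ∣              ∎)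
    where
    open ≤-Reasoning
    N = nonJoined X
    N′≤N─I : ∣ nonJoined (X ∩ I) ∣ ≤ ∣ N ─ I ∣
    N′≤N─I = p⊆q⇒∣p∣≤∣q∣ {p = nonJoined (X ∩ I)} (nonJoined-∩ I-clique)

  ∣nonJoined[vertices]∣<∣vertices∣ : ∀ (K : Clique G s) → n < 2 * s →
                                     ∣ nonJoined (vertices K) ∣ < ∣ vertices K ∣
  ∣nonJoined[vertices]∣<∣vertices∣ {s} K n<2s = <-≤-trans N<s (s≤∣vertices∣ K)
    where
    X = vertices K
    N = nonJoined X
    N<s : ∣ N ∣ < s
    N<s = +-cancelʳ-< s ∣ N ∣ s (begin-strict
      ∣ N ∣ + s        ≤⟨ +-monoʳ-≤ ∣ N ∣ (s≤∣vertices∣ K) ⟩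
      ∣ N ∣ + ∣ X ∣    ≡⟨ ≡-sym (Empty[p∩q]⇒∣p∪q∣≡∣p∣+∣q∣ N X N∩X-empty) ⟩
      ∣ N ∪ X ∣        ≤⟨ ∣p∣≤n (N ∪ X) ⟩
      n                <⟨ n<2s ⟩
      s + (s + 0)      ≡⟨ cong (s +_) (+-identityʳ s) ⟩
      s + s            ∎)
      where
      open ≤-Reasoning
      N∩X-empty : Empty (N ∩ X)
      N∩X-empty = nonJoined-disjoint (vertices-isClique K)

  module _ (avoid : (v : Fin n) → Σ (Clique G s) (λ H → ¬ v ∈V H)) where

    grow : ∀ X → Acc _<_ ∣ X ∣ → IsClique X → ∣ nonJoined X ∣ < ∣ X ∣ → Clique G (suc s)
    grow X (acc rec) X-clique N<X with 0<∣p∣⇒Nonempty X (≤-<-trans z≤n N<X)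
    ... | v , v∈X with avoid v
    ... | H , v∉H with ∣ X ─ vertices H ∣ ≤? ∣ vertices H ∩ nonJoined X ∣
    ... | no  X─I≰I∩N = IsClique⇒Clique (exchange-isClique X-clique (vertices-isClique H))
      (≤-<-trans (s≤∣vertices∣ H)
         (∣p∩r∣<∣q─p∣⇒∣p∣<∣[p─r]∪[q─p]∣ (vertices H) X (nonJoined X) (≰⇒> X─I≰I∩N)))
    ... | yes X─I≤I∩N = grow (X ∩ I) (rec X∩I<X) (IsClique-⊆ (p∩q⊆p X I) X-clique)
      (∣nonJoined[X∩I]∣<∣X∩I∣ (vertices-isClique H) X─I≤I∩N N<X)
      where
      I = vertices H
      X∩I<X : ∣ X ∩ I ∣ < ∣ X ∣
      X∩I<X = subst (∣ X ∩ I ∣ <_) (≡-sym (∣p∣≡∣p∩q∣+∣p─q∣ X I))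
        (m<m+n ∣ X ∩ I ∣ (x∈p⇒0<∣p∣ (x∈p∧x∉q⇒x∈p─q v∈X (v∉H ∘ ∈-fromDec⁻ (_∈V? H)))))

lemma3p3 : (t n : ℕ) → 3 ≤ t → n < 2 * (t ∸ 1) → (G : Graph n)
    → Clique G (t ∸ 1)
    → ((v : Fin n) → Σ (Clique G (t ∸ 1)) (λ H → ¬ (v ∈V H)))
    → Clique G t
lemma3p3 (suc s) n _ n<2s G K avoid =
  grow G avoid (vertices G K) (<-wellFounded _)
    (vertices-isClique G K) (∣nonJoined[vertices]∣<∣vertices∣ G K n<2s)
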